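{- Let $\Gamma,\Delta$ be finite multisets of $\mathcal{L}^1$-formulas and $\Sigma$ a finite multiset of outmost-boxed formulas. For every propositional variable $p$ there exists a formula $\mathcal{A}_p(\Sigma|\Gamma;\Delta)$ such that: (i) $\mathsf{V}(\mathcal{A}_p(\Sigma|\Gamma;\Delta))\subseteq\mathsf{V}(\Sigma\cup\Gamma\cup\Delta)\setminus\{p\}$; (ii) $\mathsf{G}(\mathbf{KT_n^+})\vdash\Sigma|\Gamma,\mathcal{A}_p(\Sigma|\Gamma;\Delta)\Rightarrow\Delta$; (iii) for all finite multisets $\Pi,\Lambda$ of formulas and $\Theta$ of outmost-boxed formulas with $p\notin\mathsf{V}(\Pi\cup\Lambda\cup\Theta)$ and $\mathsf{G}(\mathbf{KT_n^+})\vdash\Theta,\Sigma|\Pi,\Gamma\Rightarrow\Delta,\Lambda$, we have $\mathsf{G}(\mathbf{KT_n^+})\vdash\emptyset|\Theta,\Pi\Rightarrow\mathcal{A}_p(\Sigma|\Gamma;\Delta),\Lambda$.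
   Context: Fix a finite set $\mathsf{Agt}$ of agents and a countable set $\mathsf{Prop}$ of propositional variables. Formulas of $\mathcal{L}^1$: $A::=p\mid\bot\mid A\wedge A\mid A\vee A\mid A\rightarrow A\mid\neg A\mid\Box_i A$. An outmost-boxed formula is one of the form $\Box_jB$. $\Box_i\Gamma=\{\Box_iA:A\in\Gamma\}$; $\mathsf{V}(\cdot)$ is the set of propositional variables occurring. A T-sequent $\Sigma|\Gamma\Rightarrow\Delta$ consists of finite multisets $\Sigma,\Gamma,\Delta$, with $\Sigma$ consisting of outmost-boxed formulas. Calculus $\mathsf{G}(\mathbf{KT_n^+})$: initial T-sequents $\Sigma|\Gamma,p\Rightarrow p,\Delta$ and $\Sigma|\bot,\Gamma\Rightarrow\Delta$; logical rules are the classical G3 rules acting on the part right of "$|$" with $\Sigma$ unchanged: $(R\wedge)$ $\Sigma|\Gamma\Rightarrow\Delta,A_1$ and $\Sigma|\Gamma\Rightarrow\Delta,A_2$ / $\Sigma|\Gamma\Rightarrow\Delta,A_1\wedge A_2$; $(L\wedge)$ $\Sigma|A_1,A_2,\Gamma\Rightarrow\Delta$ / $\Sigma|A_1\wedge A_2,\Gamma\Rightarrow\Delta$; $(R\vee)$ $\Sigma|\Gamma\Rightarrow\Delta,A_1,A_2$ / $\Sigma|\Gamma\Rightarrow\Delta,A_1\vee A_2$; $(L\vee)$ $\Sigma|A_1,\Gamma\Rightarrow\Delta$ and $\Sigma|A_2,\Gamma\Rightarrow\Delta$ / $\Sigma|A_1\vee A_2,\Gamma\Rightarrow\Delta$; $(R\rightarrow)$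 $\Sigma|A_1,\Gamma\Rightarrow\Delta,A_2$ / $\Sigma|\Gamma\Rightarrow\Delta,A_1\rightarrow A_2$; $(L\rightarrow)$ $\Sigma|\Gamma\Rightarrow\Delta,A_1$ and $\Sigma|A_2,\Gamma\Rightarrow\Delta$ / $\Sigma|A_1\rightarrow A_2,\Gamma\Rightarrow\Delta$; $(R\neg)$ $\Sigma|A,\Gamma\Rightarrow\Delta$ / $\Sigma|\Gamma\Rightarrow\Delta,\neg A$; $(L\neg)$ $\Sigma|\Gamma\Rightarrow\Delta,A$ / $\Sigma|\neg A,\Gamma\Rightarrow\Delta$. Modal rules: $(\Box^+_{Kn})$: from $\emptyset|\Gamma\Rightarrow A$ infer $\Sigma,\Box_i\Gamma|\Pi\Rightarrow\Box_iA,\Omega$, where $\Sigma$ contains only formulas $\Box_jB$ with $j\neq i$, $\Pi$ only propositional variables and $\bot$, and $\Omega$ only propositional variables, $\bot$, or outmost-boxed formulas; $(\Box^+_{Tn})$: from $\Box_iA,\Sigma|\Gamma,A\Rightarrow\Delta$ infer $\Sigma|\Gamma,\Box_iA\Rightarrow\Delta$. $\vdash$ means derivable by a finite tree from initial T-sequents. -}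

module Defs where

open import Data.Nat using (ℕ)
open import Data.Fin using (Fin)
open import Data.Product using (_×_; _,_)
open import Data.List using (List; []; _∷_; _++_; map; concatMap)
open import Data.List.Membership.Propositional using (_∈_)
open import Data.List.Relation.Unary.All using (All)
open import Data.List.Relation.Binary.Permutation.Propositional using (_↭_)
open import Relation.Binary.PropositionalEquality using (_≢_)

data Fm (n : ℕ) : Set where
  var  : ℕ → Fm n
  ⊥'   : Fm n
  _∧'_ : Fm n → Fm n → Fm n
  _∨'_ : Fm n → Fm n → Fm n
  _⇒'_ : Fm n → Fm n → Fm n
  ¬'_  : Fm n → Fm n
  □    : Fin n → Fm n → Fm n

-- An outmost-boxed formula □_j B is represented by the pair (j , B).
Boxed : ℕ → Set
Boxed n = Fin n × Fm n

box : ∀ {n} → Boxed n → Fm n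
box (j , B) = □ j B

boxes : ∀ {n} → List (Boxed n) → List (Fm n)
boxes = map box

vars : ∀ {n} → Fm n → List ℕ
vars (var p)  = p ∷ []
vars ⊥'       = []
vars (A ∧' B) = vars A ++ vars B
vars (A ∨' B) = vars A ++ vars B
vars (A ⇒' B) = vars A ++ vars B
vars (¬' A)   = vars A
vars (□ i A)  = vars A

varsL : ∀ {n} → List (Fm n) → List ℕ
varsL = concatMap vars

data AtomOrBot {n : ℕ} : Fm n → Set where
  atom : ∀ p → AtomOrBot (var p)
  bot  : AtomOrBot ⊥'

data AtomBotOrBoxed {n : ℕ} : Fm n → Set where
  atom  : ∀ p → AtomBotOrBoxed (var p)
  bot   : AtomBotOrBoxed ⊥'
  boxed : ∀ j B → AtomBotOrBoxed (□ j B)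

DiffAgent : ∀ {n} → Fin n → Boxed n → Set
DiffAgent i (j , B) = j ≢ i

-- Derivability in G(KT_n^+) of the T-sequent  Σ | Γ ⇒ Δ.
-- Multisets are lists modulo permutation (rule `perm`).
infix 4 ⊢_∣_⇒_
data ⊢_∣_⇒_ {n : ℕ} : List (Boxed n) → List (Fm n) → List (Fm n) → Set where
  perm : ∀ {Σ Σ' Γ Γ' Δ Δ'} → Σ ↭ Σ' → Γ ↭ Γ' → Δ ↭ Δ' →
         ⊢ Σ ∣ Γ ⇒ Δ → ⊢ Σ' ∣ Γ' ⇒ Δ'
  ax   : ∀ {Σ Γ Δ} p → ⊢ Σ ∣ var p ∷ Γ ⇒ var p ∷ Δ
  L⊥   : ∀ {Σ Γ Δ} → ⊢ Σ ∣ ⊥' ∷ Γ ⇒ Δ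
  R∧   : ∀ {Σ Γ Δ A B} → ⊢ Σ ∣ Γ ⇒ A ∷ Δ → ⊢ Σ ∣ Γ ⇒ B ∷ Δ → ⊢ Σ ∣ Γ ⇒ (A ∧' B) ∷ Δ
  L∧   : ∀ {Σ Γ Δ A B} → ⊢ Σ ∣ A ∷ B ∷ Γ ⇒ Δ → ⊢ Σ ∣ (A ∧' B) ∷ Γ ⇒ Δ
  R∨   : ∀ {Σ Γ Δ A B} → ⊢ Σ ∣ Γ ⇒ A ∷ B ∷ Δ → ⊢ Σ ∣ Γ ⇒ (A ∨' B) ∷ Δ
  L∨   : ∀ {Σ Γ Δ A B} → ⊢ Σ ∣ A ∷ Γ ⇒ Δ → ⊢ Σ ∣ B ∷ Γ ⇒ Δ → ⊢ Σ ∣ (A ∨' B) ∷ Γ ⇒ Δ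
  R⇒   : ∀ {Σ Γ Δ A B} → ⊢ Σ ∣ A ∷ Γ ⇒ B ∷ Δ → ⊢ Σ ∣ Γ ⇒ (A ⇒' B) ∷ Δ
  L⇒   : ∀ {Σ Γ Δ A B} → ⊢ Σ ∣ Γ ⇒ A ∷ Δ → ⊢ Σ ∣ B ∷ Γ ⇒ Δ → ⊢ Σ ∣ (A ⇒' B) ∷ Γ ⇒ Δ
  R¬   : ∀ {Σ Γ Δ A} → ⊢ Σ ∣ A ∷ Γ ⇒ Δ → ⊢ Σ ∣ Γ ⇒ (¬' A) ∷ Δ
  L¬   : ∀ {Σ Γ Δ A} → ⊢ Σ ∣ Γ ⇒ A ∷ Δ → ⊢ Σ ∣ (¬' A) ∷ Γ ⇒ Δ
  □K   : ∀ {Σ Γ Π Ω A} (i : Fin n) →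
         All (DiffAgent i) Σ → All AtomOrBot Π → All AtomBotOrBoxed Ω →
         ⊢ [] ∣ Γ ⇒ A ∷ [] →
         ⊢ Σ ++ map (λ B → (i , B)) Γ ∣ Π ⇒ □ i A ∷ Ω
  □T   : ∀ {Σ Γ Δ A} (i : Fin n) →
         ⊢ (i , A) ∷ Σ ∣ A ∷ Γ ⇒ Δ → ⊢ Σ ∣ □ i A ∷ Γ ⇒ Δ

-- Following Pitts, 𝒜_p(Σ | Γ ; Δ) is defined by recursion on the T-sequent as the disjunction of
-- one formula for every rule instance that could end a derivation of Σ | Γ ⇒ Δ with its principal
-- formula in Γ or Δ: the conjunction of the interpolants of its premises, or for an axiom on q ≠ p
-- the atom q or ¬q. With □ᵢ⁻¹Σ = {B | □ᵢB ∈ Σ}, a □K-step on agent i contributes □ᵢ𝒜(□ᵢ⁻¹Σ ; C)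
-- when its principal box □ᵢC is in Δ, and ◇ᵢ𝒜(□ᵢ⁻¹Σ ; ∅) when it lies outside. The recursion
-- terminates because every step lowers a weight in which a box stored in Σ weighs less than the
-- same box in Γ.
-- Property (ii) holds disjunct by disjunct. Property (iii) is proved by induction on the derivation
-- of Θ, Σ | Π, Γ ⇒ Δ, Λ: a last rule acting on the p-free part Θ | Π ⇒ Λ is replayed below the
-- interpolant, and one acting on Σ | Γ ⇒ Δ is answered by the disjunct that anticipates it.
module Submission where

open import Defs
open import Data.Bool using (if_then_else_)
open import Data.Empty using (⊥-elim)
open import Data.Fin using (Fin)
open import Data.Fin.Properties using () renaming (_≟_ to _≟ᶠ_)
open import Data.List using (List; []; _∷_; _++_; [_]; map; concat; allFin)
open import Data.List.Membership.Propositional using (_∈_; _∉_; _─_; mapWith∈; lose)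
open import Data.List.Membership.Propositional.Properties
  using (∈-++⁺ˡ; ∈-++⁺ʳ; ∈-++⁻; ∈-map⁺; ∈-map⁻; ∈-allFin; ∈-concat⁺; ∈-concat⁻; ∈-concatMap⁺)
open import Data.List.Relation.Binary.Permutation.Propositional
open import Data.List.Relation.Binary.Permutation.Propositional.Properties
  using (shift; shifts; drop-∷; ∈-resp-↭; All-resp-↭; ++⁺ˡ; ++⁺ʳ; ∷↭∷ʳ; ++-identityʳ)
  renaming (map⁺ to ↭-map⁺)
open import Data.List.Relation.Unary.All as All using (All; []; _∷_; all?)
open import Data.List.Relation.Unary.All.Properties using (++⁺; ++⁻; ─⁺)
open import Data.List.Relation.Unary.Any using (here; there; any?)
open import Data.List.Relation.Unary.Any.Properties using (mapWith∈⁺; mapWith∈⁻)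
open import Data.Nat using (ℕ; zero; suc; _+_; _≤_; _<_; z≤n; s≤s)
open import Data.Nat.ListAction using (sum)
open import Data.Nat.ListAction.Properties using (sum-↭)
open import Data.Nat.Properties
  using (≤-trans; ≤-reflexive; n<1+n; <-≤-trans; ≤-<-trans; m≤m+n; m≤n+m; n≤1+n; +-identityʳ;
         +-monoʳ-≤; +-monoˡ-≤)
  renaming (_≟_ to _≟ℕ_)
open import Data.Nat.Tactic.RingSolver using (solve-∀)
open import Data.Product using (Σ-syntax; ∃₂; _×_; _,_; proj₁; proj₂)
open import Data.Sum using (_⊎_; inj₁; inj₂)
open import Function using (_∘_)
open import Relation.Binary.PropositionalEquality
  using (_≡_; refl; _≢_; cong; cong₂; sym; subst; module ≡-Reasoning)
  renaming (trans to ≡-trans)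
open import Relation.Nullary using (Dec; does; yes; no; ¬?; _×-dec_)
open import Relation.Unary using (Pred; _∩_)

private
  variable
    n : ℕ
    i : Fin n
    S S' Θ : List (Boxed n)
    Γ Γ' Δ Δ' Π Ω L R G : List (Fm n)
    B C D X : Fm n

module _ {a} {A : Set a} where

  ↭-swap₁ : ∀ {x y : A} {xs} → x ∷ y ∷ xs ↭ y ∷ x ∷ xs
  ↭-swap₁ = ↭-swap _ _ ↭-refl

  ↭-rotate : ∀ {x y z : A} {xs} → x ∷ y ∷ z ∷ xs ↭ y ∷ z ∷ x ∷ xs
  ↭-rotate = ↭-trans ↭-swap₁ (↭-prep _ ↭-swap₁)

  ↭-reverse₃ : ∀ {x y z : A} {xs} → x ∷ y ∷ z ∷ xs ↭ z ∷ y ∷ x ∷ xs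
  ↭-reverse₃ = ↭-trans ↭-rotate ↭-swap₁

  ↭-++-shift : ∀ ws {xs ys zs : List A} → xs ↭ ys ++ zs → ws ++ xs ↭ ys ++ ws ++ zs
  ↭-++-shift ws {ys = ys} σ = ↭-trans (++⁺ˡ ws σ) (shifts ws ys)

  All-++⁻₃ : ∀ {ℓ} {P : Pred A ℓ} xs ys {zs} → All P (xs ++ ys ++ zs) → All P xs × All P ys × All P zs
  All-++⁻₃ xs ys all = let Pxs , Pys++zs = ++⁻ xs all in Pxs , ++⁻ ys Pys++zs

  ↭∷─ : ∀ {x : A} {xs} (x∈xs : x ∈ xs) → xs ↭ x ∷ (xs ─ x∈xs)
  ↭∷─ (here refl)  = ↭-refl
  ↭∷─ (there x∈xs) = ↭-trans (↭-prep _ (↭∷─ x∈xs)) ↭-swap₁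

  ∷↭++⁻ : ∀ {x : A} {xs} ys zs → x ∷ xs ↭ ys ++ zs →
          (Σ[ x∈ys ∈ x ∈ ys ] xs ↭ (ys ─ x∈ys) ++ zs) ⊎ (Σ[ x∈zs ∈ x ∈ zs ] xs ↭ ys ++ (zs ─ x∈zs))
  ∷↭++⁻ {x = x} ys zs σ with ∈-++⁻ ys (∈-resp-↭ σ (here refl))
  ... | inj₁ x∈ys = inj₁ (x∈ys , drop-∷ (↭-trans σ (++⁺ʳ zs (↭∷─ x∈ys))))
  ... | inj₂ x∈zs = inj₂ (x∈zs , drop-∷ (↭-trans σ (↭-trans (++⁺ˡ ys (↭∷─ x∈zs)) (shift x ys (zs ─ x∈zs)))))

  when : ∀ {p} {P : Set p} → Dec P → List A → List A
  when (yes _) xs = xs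
  when (no _)  _  = []

  ∈-when⁺ : ∀ {p} {P : Set p} (P? : Dec P) {x : A} {xs} → P → x ∈ xs → x ∈ when P? xs
  ∈-when⁺ (yes _) _  x∈xs = x∈xs
  ∈-when⁺ (no ¬P) pf _    = ⊥-elim (¬P pf)

  ∈-when⁻ : ∀ {p} {P : Set p} (P? : Dec P) {x : A} {xs} → x ∈ when P? xs → P × x ∈ xs
  ∈-when⁻ (yes pf) x∈xs = pf , x∈xs

  module _ {b} {B : Set b} (f : A → List A → List B) where

    concatMapPicks : List A → List B
    concatMapPicks xs = concat (mapWith∈ xs (λ {x} x∈xs → f x (xs ─ x∈xs)))

    ∈-concatMapPicks⁺ : ∀ {x y xs} (x∈xs : x ∈ xs) → y ∈ f x (xs ─ x∈xs) → y ∈ concatMapPicks xs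
    ∈-concatMapPicks⁺ x∈xs y∈ = ∈-concat⁺ (mapWith∈⁺ _ (_ , x∈xs , y∈))

    ∈-concatMapPicks⁻ : ∀ {y} xs → y ∈ concatMapPicks xs → ∃₂ λ x (x∈xs : x ∈ xs) → y ∈ f x (xs ─ x∈xs)
    ∈-concatMapPicks⁻ xs y∈ = mapWith∈⁻ xs _ (∈-concat⁻ _ y∈)

permˢ : S ↭ S' → ⊢ S ∣ Γ ⇒ Δ → ⊢ S' ∣ Γ ⇒ Δ
permˢ σ = perm σ ↭-refl ↭-refl

permˡ : Γ ↭ Γ' → ⊢ S ∣ Γ ⇒ Δ → ⊢ S ∣ Γ' ⇒ Δ
permˡ γ = perm ↭-refl γ ↭-refl

permʳ : Δ ↭ Δ' → ⊢ S ∣ Γ ⇒ Δ → ⊢ S ∣ Γ ⇒ Δ'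
permʳ δ = perm ↭-refl ↭-refl δ

weakenˡ-AtomOrBot : AtomOrBot X → ⊢ S ∣ Γ ⇒ Δ → ⊢ S ∣ X ∷ Γ ⇒ Δ
weakenˡ-AtomOrBot a (perm σ γ δ d) = perm σ (↭-prep _ γ) δ (weakenˡ-AtomOrBot a d)
weakenˡ-AtomOrBot a (ax q)         = permˡ ↭-swap₁ (ax q)
weakenˡ-AtomOrBot a L⊥             = permˡ ↭-swap₁ L⊥
weakenˡ-AtomOrBot a (R∧ d e)       = R∧ (weakenˡ-AtomOrBot a d) (weakenˡ-AtomOrBot a e)
weakenˡ-AtomOrBot a (L∧ d)         = permˡ ↭-swap₁ (L∧ (permˡ ↭-rotate (weakenˡ-AtomOrBot a d)))
weakenˡ-AtomOrBot a (R∨ d)         = R∨ (weakenˡ-AtomOrBot a d)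
weakenˡ-AtomOrBot a (L∨ d e)       =
  permˡ ↭-swap₁ (L∨ (permˡ ↭-swap₁ (weakenˡ-AtomOrBot a d)) (permˡ ↭-swap₁ (weakenˡ-AtomOrBot a e)))
weakenˡ-AtomOrBot a (R⇒ d)         = R⇒ (permˡ ↭-swap₁ (weakenˡ-AtomOrBot a d))
weakenˡ-AtomOrBot a (L⇒ d e)       =
  permˡ ↭-swap₁ (L⇒ (weakenˡ-AtomOrBot a d) (permˡ ↭-swap₁ (weakenˡ-AtomOrBot a e)))
weakenˡ-AtomOrBot a (R¬ d)         = R¬ (permˡ ↭-swap₁ (weakenˡ-AtomOrBot a d))
weakenˡ-AtomOrBot a (L¬ d)         = permˡ ↭-swap₁ (L¬ (weakenˡ-AtomOrBot a d))
weakenˡ-AtomOrBot a (□K i s π ω d) = □K i s (a ∷ π) ω d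
weakenˡ-AtomOrBot a (□T i d)       = permˡ ↭-swap₁ (□T i (permˡ ↭-swap₁ (weakenˡ-AtomOrBot a d)))

weakenʳ-AtomBotOrBoxed : AtomBotOrBoxed X → ⊢ S ∣ Γ ⇒ Δ → ⊢ S ∣ Γ ⇒ X ∷ Δ
weakenʳ-AtomBotOrBoxed a (perm σ γ δ d) = perm σ γ (↭-prep _ δ) (weakenʳ-AtomBotOrBoxed a d)
weakenʳ-AtomBotOrBoxed a (ax q)         = permʳ ↭-swap₁ (ax q)
weakenʳ-AtomBotOrBoxed a L⊥             = L⊥
weakenʳ-AtomBotOrBoxed a (R∧ d e)       =
  permʳ ↭-swap₁ (R∧ (permʳ ↭-swap₁ (weakenʳ-AtomBotOrBoxed a d)) (permʳ ↭-swap₁ (weakenʳ-AtomBotOrBoxed a e)))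
weakenʳ-AtomBotOrBoxed a (L∧ d)         = L∧ (weakenʳ-AtomBotOrBoxed a d)
weakenʳ-AtomBotOrBoxed a (R∨ d)         = permʳ ↭-swap₁ (R∨ (permʳ ↭-rotate (weakenʳ-AtomBotOrBoxed a d)))
weakenʳ-AtomBotOrBoxed a (L∨ d e)       = L∨ (weakenʳ-AtomBotOrBoxed a d) (weakenʳ-AtomBotOrBoxed a e)
weakenʳ-AtomBotOrBoxed a (R⇒ d)         = permʳ ↭-swap₁ (R⇒ (permʳ ↭-swap₁ (weakenʳ-AtomBotOrBoxed a d)))
weakenʳ-AtomBotOrBoxed a (L⇒ d e)       =
  L⇒ (permʳ ↭-swap₁ (weakenʳ-AtomBotOrBoxed a d)) (weakenʳ-AtomBotOrBoxed a e)
weakenʳ-AtomBotOrBoxed a (R¬ d)         = permʳ ↭-swap₁ (R¬ (weakenʳ-AtomBotOrBoxed a d))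
weakenʳ-AtomBotOrBoxed a (L¬ d)         = L¬ (permʳ ↭-swap₁ (weakenʳ-AtomBotOrBoxed a d))
weakenʳ-AtomBotOrBoxed a (□K i s π ω d) = permʳ ↭-swap₁ (□K i s π (a ∷ ω) d)
weakenʳ-AtomBotOrBoxed a (□T i d)       = □T i (weakenʳ-AtomBotOrBoxed a d)

-- Weakening Σ by a box of agent i must weaken the premise of a □K-step for the
-- same agent on the left, whence the mutual recursion.
mutual
  weakenˡ : ∀ X → ⊢ S ∣ Γ ⇒ Δ → ⊢ S ∣ X ∷ Γ ⇒ Δ
  weakenˡ (var q)  d = weakenˡ-AtomOrBot (atom q) d
  weakenˡ ⊥'       d = L⊥
  weakenˡ (C ∧' D) d = L∧ (weakenˡ C (weakenˡ D d))
  weakenˡ (C ∨' D) d = L∨ (weakenˡ C d) (weakenˡ D d)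
  weakenˡ (C ⇒' D) d = L⇒ (weakenʳ C d) (weakenˡ D d)
  weakenˡ (¬' C)   d = L¬ (weakenʳ C d)
  weakenˡ (□ j C)  d = □T j (weakenˡ C (weakenᴮ j C d))

  weakenʳ : ∀ X → ⊢ S ∣ Γ ⇒ Δ → ⊢ S ∣ Γ ⇒ X ∷ Δ
  weakenʳ (var q)  d = weakenʳ-AtomBotOrBoxed (atom q) d
  weakenʳ ⊥'       d = weakenʳ-AtomBotOrBoxed bot d
  weakenʳ (□ j C)  d = weakenʳ-AtomBotOrBoxed (boxed j C) d
  weakenʳ (C ∧' D) d = R∧ (weakenʳ C d) (weakenʳ D d)
  weakenʳ (C ∨' D) d = R∨ (weakenʳ C (weakenʳ D d))
  weakenʳ (C ⇒' D) d = R⇒ (weakenˡ C (weakenʳ D d))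
  weakenʳ (¬' C)   d = R¬ (weakenˡ C d)

  weakenᴮ : ∀ j C → ⊢ S ∣ Γ ⇒ Δ → ⊢ (j , C) ∷ S ∣ Γ ⇒ Δ
  weakenᴮ j C (perm σ γ δ d) = perm (↭-prep _ σ) γ δ (weakenᴮ j C d)
  weakenᴮ j C (ax q)         = ax q
  weakenᴮ j C L⊥             = L⊥
  weakenᴮ j C (R∧ d e)       = R∧ (weakenᴮ j C d) (weakenᴮ j C e)
  weakenᴮ j C (L∧ d)         = L∧ (weakenᴮ j C d)
  weakenᴮ j C (R∨ d)         = R∨ (weakenᴮ j C d)
  weakenᴮ j C (L∨ d e)       = L∨ (weakenᴮ j C d) (weakenᴮ j C e)
  weakenᴮ j C (R⇒ d)         = R⇒ (weakenᴮ j C d)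
  weakenᴮ j C (L⇒ d e)       = L⇒ (weakenᴮ j C d) (weakenᴮ j C e)
  weakenᴮ j C (R¬ d)         = R¬ (weakenᴮ j C d)
  weakenᴮ j C (L¬ d)         = L¬ (weakenᴮ j C d)
  weakenᴮ j C (□T i d)       = □T i (permˢ ↭-swap₁ (weakenᴮ j C d))
  weakenᴮ j C (□K {Σ = S} {Γ = G} i s π ω d) with j ≟ᶠ i
  ... | yes refl = permˢ (shift (i , C) S (map (i ,_) G)) (□K i s π ω (weakenˡ C d))
  ... | no  j≢i  = □K i (j≢i ∷ s) π ω d

□T-many : ∀ Θ → ⊢ Θ ++ S ∣ Γ ⇒ Δ → ⊢ S ∣ boxes Θ ++ Γ ⇒ Δ
□T-many []            d = d
□T-many ((i , C) ∷ Θ) d = □T i (weakenˡ C (□T-many Θ (permˢ (shifts [ i , C ] Θ) d)))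

focusˡ : ∀ Π (X∈Γ : X ∈ Γ) → ⊢ S ∣ X ∷ Π ++ Γ ─ X∈Γ ⇒ Δ → ⊢ S ∣ Π ++ Γ ⇒ Δ
focusˡ Π X∈Γ = permˡ (↭-trans (shifts [ _ ] Π) (++⁺ˡ Π (↭-sym (↭∷─ X∈Γ))))

focusʳ : ∀ Λ (X∈Δ : X ∈ Δ) → ⊢ S ∣ Γ ⇒ X ∷ Λ ++ Δ ─ X∈Δ → ⊢ S ∣ Γ ⇒ Λ ++ Δ
focusʳ Λ X∈Δ = permʳ (↭-trans (shifts [ _ ] Λ) (++⁺ˡ Λ (↭-sym (↭∷─ X∈Δ))))

boxedBy : Fin n → List (Boxed n) → List (Fm n)
boxedBy i []            = []
boxedBy i ((j , C) ∷ S) = if does (j ≟ᶠ i) then C ∷ boxedBy i S else boxedBy i S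

boxedByOthers : Fin n → List (Boxed n) → List (Boxed n)
boxedByOthers i []            = []
boxedByOthers i ((j , C) ∷ S) = if does (j ≟ᶠ i) then boxedByOthers i S else (j , C) ∷ boxedByOthers i S

boxedByOthers-DiffAgent : ∀ (i : Fin n) S → All (DiffAgent i) (boxedByOthers i S)
boxedByOthers-DiffAgent i []            = []
boxedByOthers-DiffAgent i ((j , C) ∷ S) with j ≟ᶠ i
... | yes _   = boxedByOthers-DiffAgent i S
... | no  j≢i = j≢i ∷ boxedByOthers-DiffAgent i S

↭-boxedBy : ∀ (i : Fin n) S → S ↭ boxedByOthers i S ++ map (i ,_) (boxedBy i S)
↭-boxedBy i []            = ↭-refl
↭-boxedBy i ((j , C) ∷ S) with j ≟ᶠ i
... | yes refl = ↭-trans (↭-prep _ (↭-boxedBy i S)) (shifts [ i , C ] (boxedByOthers i S))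
... | no  _    = ↭-prep _ (↭-boxedBy i S)

boxedBy-++ : ∀ (i : Fin n) S S' → boxedBy i (S ++ S') ≡ boxedBy i S ++ boxedBy i S'
boxedBy-++ i []            S' = refl
boxedBy-++ i ((j , C) ∷ S) S' with j ≟ᶠ i
... | yes _ = cong (C ∷_) (boxedBy-++ i S S')
... | no  _ = boxedBy-++ i S S'

boxedBy-DiffAgent : All (DiffAgent i) S → boxedBy i S ≡ []
boxedBy-DiffAgent []                                = refl
boxedBy-DiffAgent {i = i} {S = (j , C) ∷ S} (j≢i ∷ s) with j ≟ᶠ i
... | yes j≡i = ⊥-elim (j≢i j≡i)
... | no  _   = boxedBy-DiffAgent s

boxedBy-map : ∀ (i : Fin n) G → boxedBy i (map (i ,_) G) ≡ G
boxedBy-map i []      = refl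
boxedBy-map i (C ∷ G) with i ≟ᶠ i
... | yes _   = cong (C ∷_) (boxedBy-map i G)
... | no  i≢i = ⊥-elim (i≢i refl)

boxedBy-↭ : ∀ (i : Fin n) → S ↭ S' → boxedBy i S ↭ boxedBy i S'
boxedBy-↭ i refl              = ↭-refl
boxedBy-↭ i (prep (j , C) σ) with j ≟ᶠ i
... | yes _ = ↭-prep C (boxedBy-↭ i σ)
... | no  _ = boxedBy-↭ i σ
boxedBy-↭ i (swap (j , C) (j' , C') σ) with j ≟ᶠ i | j' ≟ᶠ i
... | yes _ | yes _ = ↭-swap C C' (boxedBy-↭ i σ)
... | yes _ | no  _ = ↭-prep C (boxedBy-↭ i σ)
... | no  _ | yes _ = ↭-prep C' (boxedBy-↭ i σ)
... | no  _ | no  _ = boxedBy-↭ i σ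
boxedBy-↭ i (trans σ σ')      = ↭-trans (boxedBy-↭ i σ) (boxedBy-↭ i σ')

All-boxedBy : ∀ {ℓ} {P : Fm n → Set ℓ} (i : Fin n) S → All P (boxes S) → All (P ∘ □ i) (boxedBy i S)
All-boxedBy i []            []       = []
All-boxedBy i ((j , C) ∷ S) (pC ∷ ps) with j ≟ᶠ i
... | yes refl = pC ∷ All-boxedBy i S ps
... | no  _    = All-boxedBy i S ps

boxedBy-∷ : ∀ (i : Fin n) B S → boxedBy i ((i , B) ∷ S) ≡ B ∷ boxedBy i S
boxedBy-∷ i B S with i ≟ᶠ i
... | yes _   = refl
... | no  i≢i = ⊥-elim (i≢i refl)

boxedBy-□K : All (DiffAgent i) S → S ++ map (i ,_) G ↭ S' → G ↭ boxedBy i S'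
boxedBy-□K {i = i} {S = S} {G = G} s σ = subst (_↭ _) boxedBy-context (boxedBy-↭ i σ)
  where
    open ≡-Reasoning
    boxedBy-context : boxedBy i (S ++ map (i ,_) G) ≡ G
    boxedBy-context = begin
      boxedBy i (S ++ map (i ,_) G)           ≡⟨ boxedBy-++ i S _ ⟩
      boxedBy i S ++ boxedBy i (map (i ,_) G) ≡⟨ cong₂ _++_ (boxedBy-DiffAgent s) (boxedBy-map i G) ⟩
      G                                       ∎

□K-boxedBy : All AtomOrBot Π → All AtomBotOrBoxed Ω → ⊢ [] ∣ boxedBy i S ⇒ C ∷ [] → ⊢ S ∣ Π ⇒ □ i C ∷ Ω
□K-boxedBy {i = i} {S = S} π ω d = permˢ (↭-sym (↭-boxedBy i S)) (□K i (boxedByOthers-DiffAgent i S) π ω d)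

⋁ : List (Fm n) → Fm n
⋁ []       = ⊥'
⋁ (B ∷ Bs) = B ∨' ⋁ Bs

R⋁ : ∀ {Bs} → B ∈ Bs → ⊢ S ∣ Γ ⇒ B ∷ Δ → ⊢ S ∣ Γ ⇒ ⋁ Bs ∷ Δ
R⋁ {Bs = _ ∷ Bs} (here refl) d = R∨ (permʳ ↭-swap₁ (weakenʳ (⋁ Bs) d))
R⋁ {Bs = B ∷ _}  (there B∈)  d = R∨ (weakenʳ B (R⋁ B∈ d))

L⋁ : ∀ Bs → (∀ {B} → B ∈ Bs → ⊢ S ∣ B ∷ Γ ⇒ Δ) → ⊢ S ∣ ⋁ Bs ∷ Γ ⇒ Δ
L⋁ []       h = L⊥
L⋁ (B ∷ Bs) h = L∨ (h (here refl)) (L⋁ Bs (h ∘ there))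

VarsIn : ∀ {ℓ} → Pred ℕ ℓ → Fm n → Set ℓ
VarsIn T B = All T (vars B)

VarsIn-⋁ : ∀ {ℓ} {T : Pred ℕ ℓ} (Bs : List (Fm n)) → (∀ {B} → B ∈ Bs → VarsIn T B) → VarsIn T (⋁ Bs)
VarsIn-⋁ []       h = []
VarsIn-⋁ (B ∷ Bs) h = ++⁺ (h (here refl)) (VarsIn-⋁ Bs (h ∘ there))

All-VarsIn : ∀ {ℓ} {T : Pred ℕ ℓ} (Γ : List (Fm n)) → (∀ {q} → q ∈ varsL Γ → T q) → All (VarsIn T) Γ
All-VarsIn Γ h = All.tabulate λ B∈Γ → All.tabulate λ q∈B → h (∈-concatMap⁺ vars (lose B∈Γ q∈B))

-- □T trades □ i C on the left for C there and (i , C) in Σ, so a box must outweigh both.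
weight : Fm n → ℕ
weight (var _)  = 1
weight ⊥'       = 1
weight (C ∧' D) = suc (weight C + weight D)
weight (C ∨' D) = suc (weight C + weight D)
weight (C ⇒' D) = suc (weight C + weight D)
weight (¬' C)   = suc (weight C)
weight (□ i C)  = suc (suc (weight C + weight C))

weights : List (Fm n) → ℕ
weights = sum ∘ map weight

boxWeights : List (Boxed n) → ℕ
boxWeights = sum ∘ map (suc ∘ weight ∘ proj₂)

size : List (Boxed n) → List (Fm n) → List (Fm n) → ℕ
size S Γ Δ = boxWeights S + (weights Γ + weights Δ)

weights-─ : (X∈Γ : X ∈ Γ) → weights Γ ≡ weight X + weights (Γ ─ X∈Γ)
weights-─ X∈Γ = sum-↭ (↭-map⁺ weight (↭∷─ X∈Γ))

weights-boxedBy : ∀ (i : Fin n) S → weights (boxedBy i S) ≤ boxWeights S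
weights-boxedBy i []            = z≤n
weights-boxedBy i ((j , C) ∷ S) with j ≟ᶠ i
... | yes _ = ≤-trans (+-monoʳ-≤ (weight C) (weights-boxedBy i S)) (n≤1+n _)
... | no  _ = ≤-trans (weights-boxedBy i S) (m≤n+m _ _)

weights-boxedBy-< : ∀ (i : Fin n) S → boxedBy i S ≡ C ∷ G → weights (boxedBy i S) < boxWeights S
weights-boxedBy-< i ((j , C) ∷ S) eq with j ≟ᶠ i
... | yes _ = s≤s (+-monoʳ-≤ (weight C) (weights-boxedBy i S))
... | no  _ = ≤-trans (weights-boxedBy-< i S eq) (m≤n+m _ _)

<-of-≡ : ∀ {m n} k → n ≡ suc (m + k) → m < n
<-of-≡ {m} k refl = s≤s (m≤m+n m k)

module _ (S : List (Boxed n)) (Γ Δ : List (Fm n)) where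

  private
    shrinkˡ : ∀ {m} (X∈Γ : X ∈ Γ) k →
              boxWeights S + ((weight X + weights (Γ ─ X∈Γ)) + weights Δ) ≡ suc (m + k) → m < size S Γ Δ
    shrinkˡ X∈Γ k eq = <-of-≡ k (≡-trans (cong (λ w → boxWeights S + (w + weights Δ)) (weights-─ X∈Γ)) eq)

    shrinkʳ : ∀ {m} (X∈Δ : X ∈ Δ) k →
              boxWeights S + (weights Γ + (weight X + weights (Δ ─ X∈Δ))) ≡ suc (m + k) → m < size S Γ Δ
    shrinkʳ X∈Δ k eq = <-of-≡ k (≡-trans (cong (λ w → boxWeights S + (weights Γ + w)) (weights-─ X∈Δ)) eq)

  size-L∧ : (X∈Γ : C ∧' D ∈ Γ) → size S (C ∷ D ∷ Γ ─ X∈Γ) Δ < size S Γ Δ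
  size-L∧ {C = C} {D = D} X∈Γ =
    shrinkˡ X∈Γ 0 (e (boxWeights S) (weight C) (weight D) (weights (Γ ─ X∈Γ)) (weights Δ))
    where e : ∀ s c d r δ → s + ((suc (c + d) + r) + δ) ≡ suc ((s + ((c + (d + r)) + δ)) + 0)
          e = solve-∀

  size-L∨₁ : (X∈Γ : C ∨' D ∈ Γ) → size S (C ∷ Γ ─ X∈Γ) Δ < size S Γ Δ
  size-L∨₁ {C = C} {D = D} X∈Γ =
    shrinkˡ X∈Γ (weight D) (e (boxWeights S) (weight C) (weight D) (weights (Γ ─ X∈Γ)) (weights Δ))
    where e : ∀ s c d r δ → s + ((suc (c + d) + r) + δ) ≡ suc ((s + ((c + r) + δ)) + d)
          e = solve-∀

  size-L∨₂ : (X∈Γ : C ∨' D ∈ Γ) → size S (D ∷ Γ ─ X∈Γ) Δ < size S Γ Δ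
  size-L∨₂ {C = C} {D = D} X∈Γ =
    shrinkˡ X∈Γ (weight C) (e (boxWeights S) (weight C) (weight D) (weights (Γ ─ X∈Γ)) (weights Δ))
    where e : ∀ s c d r δ → s + ((suc (c + d) + r) + δ) ≡ suc ((s + ((d + r) + δ)) + c)
          e = solve-∀

  size-L⇒₁ : (X∈Γ : C ⇒' D ∈ Γ) → size S (Γ ─ X∈Γ) (C ∷ Δ) < size S Γ Δ
  size-L⇒₁ {C = C} {D = D} X∈Γ =
    shrinkˡ X∈Γ (weight D) (e (boxWeights S) (weight C) (weight D) (weights (Γ ─ X∈Γ)) (weights Δ))
    where e : ∀ s c d r δ → s + ((suc (c + d) + r) + δ) ≡ suc ((s + (r + (c + δ))) + d)
          e = solve-∀

  size-L⇒₂ : (X∈Γ : C ⇒' D ∈ Γ) → size S (D ∷ Γ ─ X∈Γ) Δ < size S Γ Δ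
  size-L⇒₂ {C = C} {D = D} X∈Γ =
    shrinkˡ X∈Γ (weight C) (e (boxWeights S) (weight C) (weight D) (weights (Γ ─ X∈Γ)) (weights Δ))
    where e : ∀ s c d r δ → s + ((suc (c + d) + r) + δ) ≡ suc ((s + ((d + r) + δ)) + c)
          e = solve-∀

  size-L¬ : (X∈Γ : ¬' C ∈ Γ) → size S (Γ ─ X∈Γ) (C ∷ Δ) < size S Γ Δ
  size-L¬ {C = C} X∈Γ = shrinkˡ X∈Γ 0 (e (boxWeights S) (weight C) (weights (Γ ─ X∈Γ)) (weights Δ))
    where e : ∀ s c r δ → s + ((suc c + r) + δ) ≡ suc ((s + (r + (c + δ))) + 0)
          e = solve-∀

  size-L□ : (X∈Γ : □ i C ∈ Γ) → size ((i , C) ∷ S) (C ∷ Γ ─ X∈Γ) Δ < size S Γ Δ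
  size-L□ {C = C} X∈Γ = shrinkˡ X∈Γ 0 (e (boxWeights S) (weight C) (weights (Γ ─ X∈Γ)) (weights Δ))
    where e : ∀ s c r δ → s + ((suc (suc (c + c)) + r) + δ) ≡ suc (((suc c + s) + ((c + r) + δ)) + 0)
          e = solve-∀

  size-R∧₁ : (X∈Δ : C ∧' D ∈ Δ) → size S Γ (C ∷ Δ ─ X∈Δ) < size S Γ Δ
  size-R∧₁ {C = C} {D = D} X∈Δ =
    shrinkʳ X∈Δ (weight D) (e (boxWeights S) (weights Γ) (weight C) (weight D) (weights (Δ ─ X∈Δ)))
    where e : ∀ s g c d r → s + (g + (suc (c + d) + r)) ≡ suc ((s + (g + (c + r))) + d)
          e = solve-∀

  size-R∧₂ : (X∈Δ : C ∧' D ∈ Δ) → size S Γ (D ∷ Δ ─ X∈Δ) < size S Γ Δ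
  size-R∧₂ {C = C} {D = D} X∈Δ =
    shrinkʳ X∈Δ (weight C) (e (boxWeights S) (weights Γ) (weight C) (weight D) (weights (Δ ─ X∈Δ)))
    where e : ∀ s g c d r → s + (g + (suc (c + d) + r)) ≡ suc ((s + (g + (d + r))) + c)
          e = solve-∀

  size-R∨ : (X∈Δ : C ∨' D ∈ Δ) → size S Γ (C ∷ D ∷ Δ ─ X∈Δ) < size S Γ Δ
  size-R∨ {C = C} {D = D} X∈Δ =
    shrinkʳ X∈Δ 0 (e (boxWeights S) (weights Γ) (weight C) (weight D) (weights (Δ ─ X∈Δ)))
    where e : ∀ s g c d r → s + (g + (suc (c + d) + r)) ≡ suc ((s + (g + (c + (d + r)))) + 0)
          e = solve-∀

  size-R⇒ : (X∈Δ : C ⇒' D ∈ Δ) → size S (C ∷ Γ) (D ∷ Δ ─ X∈Δ) < size S Γ Δ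
  size-R⇒ {C = C} {D = D} X∈Δ =
    shrinkʳ X∈Δ 0 (e (boxWeights S) (weights Γ) (weight C) (weight D) (weights (Δ ─ X∈Δ)))
    where e : ∀ s g c d r → s + (g + (suc (c + d) + r)) ≡ suc ((s + ((c + g) + (d + r))) + 0)
          e = solve-∀

  size-R¬ : (X∈Δ : ¬' C ∈ Δ) → size S (C ∷ Γ) (Δ ─ X∈Δ) < size S Γ Δ
  size-R¬ {C = C} X∈Δ = shrinkʳ X∈Δ 0 (e (boxWeights S) (weights Γ) (weight C) (weights (Δ ─ X∈Δ)))
    where e : ∀ s g c r → s + (g + (suc c + r)) ≡ suc ((s + ((c + g) + r)) + 0)
          e = solve-∀

  size-R□ : (X∈Δ : □ i C ∈ Δ) → size [] (boxedBy i S) [ C ] < size S Γ Δ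
  size-R□ {i = i} {C = C} X∈Δ =
    ≤-<-trans (+-monoˡ-≤ (weight C + 0) (weights-boxedBy i S))
              (shrinkʳ X∈Δ (suc (weights Γ + (weight C + weights (Δ ─ X∈Δ))))
                (e (boxWeights S) (weights Γ) (weight C) (weights (Δ ─ X∈Δ))))
    where e : ∀ s g c r → s + (g + (suc (suc (c + c)) + r)) ≡ suc ((s + (c + 0)) + suc (g + (c + r)))
          e = solve-∀

  size-◇ : ∀ i → boxedBy i S ≡ C ∷ G → size [] (C ∷ G) [] < size S Γ Δ
  size-◇ i eq = subst (λ G′ → size [] G′ [] < size S Γ Δ) eq
    (≤-<-trans (≤-reflexive (+-identityʳ _)) (<-≤-trans (weights-boxedBy-< i S eq) (m≤m+n _ _)))

atomOrBot? : (B : Fm n) → Dec (AtomOrBot B)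
atomOrBot? (var q)  = yes (atom q)
atomOrBot? ⊥'       = yes bot
atomOrBot? (_ ∧' _) = no λ ()
atomOrBot? (_ ∨' _) = no λ ()
atomOrBot? (_ ⇒' _) = no λ ()
atomOrBot? (¬' _)   = no λ ()
atomOrBot? (□ _ _)  = no λ ()

atomBotOrBoxed? : (B : Fm n) → Dec (AtomBotOrBoxed B)
atomBotOrBoxed? (var q)  = yes (atom q)
atomBotOrBoxed? ⊥'       = yes bot
atomBotOrBoxed? (□ j C)  = yes (boxed j C)
atomBotOrBoxed? (_ ∧' _) = no λ ()
atomBotOrBoxed? (_ ∨' _) = no λ ()
atomBotOrBoxed? (_ ⇒' _) = no λ ()
atomBotOrBoxed? (¬' _)   = no λ ()

var≡? : ∀ q (B : Fm n) → Dec (var q ≡ B)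
var≡? q (var r) with q ≟ℕ r
... | yes refl = yes refl
... | no  q≢r  = no λ { refl → q≢r refl }
var≡? q ⊥'       = no λ ()
var≡? q (_ ∧' _) = no λ ()
var≡? q (_ ∨' _) = no λ ()
var≡? q (_ ⇒' _) = no λ ()
var≡? q (¬' _)   = no λ ()
var≡? q (□ _ _)  = no λ ()

-- Γ ⇒ Δ meets the side conditions that □K imposes on its conclusion Π ⇒ □ᵢA, Ω.
Critical : List (Fm n) → List (Fm n) → Set
Critical Γ Δ = All AtomOrBot Γ × All AtomBotOrBoxed Δ

critical? : (Γ Δ : List (Fm n)) → Dec (Critical Γ Δ)
critical? Γ Δ = all? atomOrBot? Γ ×-dec all? atomBotOrBoxed? Δ

⊤' : Fm n
⊤' = ¬' ⊥'

Interpolant : ℕ → Set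
Interpolant n = List (Boxed n) → List (Fm n) → List (Fm n) → Fm n

-- 𝒜 k S Γ Δ is 𝒜_p(S | Γ ; Δ) computed with fuel k; any k > size S Γ Δ is enough.
module UniformInterpolant {n : ℕ} (p : ℕ) where

  leftDisjuncts : Interpolant n → List (Boxed n) → List (Fm n) → Fm n → List (Fm n) → List (Fm n)
  leftDisjuncts A S Δ (var q)  Γ' = when (¬? (q ≟ℕ p)) [ ¬' var q ]
  leftDisjuncts A S Δ ⊥'       Γ' = [ ⊤' ]
  leftDisjuncts A S Δ (C ∧' D) Γ' = [ A S (C ∷ D ∷ Γ') Δ ]
  leftDisjuncts A S Δ (C ∨' D) Γ' = [ A S (C ∷ Γ') Δ ∧' A S (D ∷ Γ') Δ ]
  leftDisjuncts A S Δ (C ⇒' D) Γ' = [ A S Γ' (C ∷ Δ) ∧' A S (D ∷ Γ') Δ ]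
  leftDisjuncts A S Δ (¬' C)   Γ' = [ A S Γ' (C ∷ Δ) ]
  leftDisjuncts A S Δ (□ i C)  Γ' = [ A ((i , C) ∷ S) (C ∷ Γ') Δ ]

  rightDisjuncts : Interpolant n → List (Boxed n) → List (Fm n) → List (Fm n) → Fm n → List (Fm n) → List (Fm n)
  rightDisjuncts A S Γ Δ (var q)  Δ' = when (¬? (q ≟ℕ p)) [ var q ] ++ when (any? (var≡? q) Γ) [ ⊤' ]
  rightDisjuncts A S Γ Δ ⊥'       Δ' = []
  rightDisjuncts A S Γ Δ (C ∧' D) Δ' = [ A S Γ (C ∷ Δ') ∧' A S Γ (D ∷ Δ') ]
  rightDisjuncts A S Γ Δ (C ∨' D) Δ' = [ A S Γ (C ∷ D ∷ Δ') ]
  rightDisjuncts A S Γ Δ (C ⇒' D) Δ' = [ A S (C ∷ Γ) (D ∷ Δ') ]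
  rightDisjuncts A S Γ Δ (¬' C)   Δ' = [ A S (C ∷ Γ) Δ' ]
  rightDisjuncts A S Γ Δ (□ i C)  Δ' = when (critical? Γ Δ) [ □ i (A [] (boxedBy i S) [ C ]) ]

  -- ◇ᵢ A(□ᵢ⁻¹S ; ∅) with □ᵢ⁻¹S = boxedBy i S, replaced by ⊥ when □ᵢ⁻¹S is empty: only
  -- otherwise does the recursive call shrink the sequent.
  ◇-disjunct : Interpolant n → Fin n → List (Fm n) → Fm n
  ◇-disjunct A i []      = ⊥'
  ◇-disjunct A i (B ∷ G) = ¬' □ i (¬' A [] (B ∷ G) [])

  disjuncts : Interpolant n → List (Boxed n) → List (Fm n) → List (Fm n) → List (Fm n)
  disjuncts A S Γ Δ =
    concatMapPicks (leftDisjuncts A S Δ) Γ ++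
    concatMapPicks (rightDisjuncts A S Γ Δ) Δ ++
    when (critical? Γ Δ) (map (λ i → ◇-disjunct A i (boxedBy i S)) (allFin n))

  𝒜 : ℕ → Interpolant n
  𝒜 zero    S Γ Δ = ⊥'
  𝒜 (suc k) S Γ Δ = ⋁ (disjuncts (𝒜 k) S Γ Δ)

  data Disjunct (A : Interpolant n) (S : List (Boxed n)) (Γ Δ : List (Fm n)) (D : Fm n) : Set where
    left    : (X∈Γ : X ∈ Γ) → D ∈ leftDisjuncts A S Δ X (Γ ─ X∈Γ) → Disjunct A S Γ Δ D
    right   : (X∈Δ : X ∈ Δ) → D ∈ rightDisjuncts A S Γ Δ X (Δ ─ X∈Δ) → Disjunct A S Γ Δ D
    diamond : Critical Γ Δ → ∀ i → D ≡ ◇-disjunct A i (boxedBy i S) → Disjunct A S Γ Δ D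

  ∈-disjuncts⁻ : ∀ A S Γ Δ → D ∈ disjuncts A S Γ Δ → Disjunct A S Γ Δ D
  ∈-disjuncts⁻ A S Γ Δ D∈ with ∈-++⁻ (concatMapPicks (leftDisjuncts A S Δ) Γ) D∈
  ... | inj₁ D∈ˡ with ∈-concatMapPicks⁻ (leftDisjuncts A S Δ) Γ D∈ˡ
  ...   | _ , X∈Γ , D∈′ = left X∈Γ D∈′
  ∈-disjuncts⁻ A S Γ Δ D∈ | inj₂ D∈ʳ with ∈-++⁻ (concatMapPicks (rightDisjuncts A S Γ Δ) Δ) D∈ʳ
  ... | inj₁ D∈ʳ′ with ∈-concatMapPicks⁻ (rightDisjuncts A S Γ Δ) Δ D∈ʳ′
  ...   | _ , X∈Δ , D∈′ = right X∈Δ D∈′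
  ∈-disjuncts⁻ A S Γ Δ D∈ | inj₂ D∈ʳ | inj₂ D∈◇ with ∈-when⁻ (critical? Γ Δ) D∈◇
  ... | c , D∈map with ∈-map⁻ _ D∈map
  ...   | i , _ , refl = diamond c i refl

  module _ {ℓ} {T : Pred ℕ ℓ} where

    𝒜-vars : ∀ k S Γ Δ → All (VarsIn T) (boxes S) → All (VarsIn T) Γ → All (VarsIn T) Δ →
             VarsIn (T ∩ (_≢ p)) (𝒜 k S Γ Δ)

    leftDisjuncts-vars : ∀ k S Δ X {r} → All (VarsIn T) (boxes S) → All (VarsIn T) Δ →
                         VarsIn T X → All (VarsIn T) r →
                         D ∈ leftDisjuncts (𝒜 k) S Δ X r → VarsIn (T ∩ (_≢ p)) D
    leftDisjuncts-vars k S Δ (var q) tS tΔ (tq ∷ []) tr D∈ with ∈-when⁻ (¬? (q ≟ℕ p)) D∈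
    ... | q≢p , here refl = (tq , q≢p) ∷ []
    leftDisjuncts-vars k S Δ ⊥'           tS tΔ tX tr (here refl) = []
    leftDisjuncts-vars k S Δ (C ∧' D) {r} tS tΔ tX tr (here refl) =
      let tC , tD = ++⁻ (vars C) tX in 𝒜-vars k S (C ∷ D ∷ r) Δ tS (tC ∷ tD ∷ tr) tΔ
    leftDisjuncts-vars k S Δ (C ∨' D) {r} tS tΔ tX tr (here refl) =
      let tC , tD = ++⁻ (vars C) tX in
      ++⁺ (𝒜-vars k S (C ∷ r) Δ tS (tC ∷ tr) tΔ) (𝒜-vars k S (D ∷ r) Δ tS (tD ∷ tr) tΔ)
    leftDisjuncts-vars k S Δ (C ⇒' D) {r} tS tΔ tX tr (here refl) =
      let tC , tD = ++⁻ (vars C) tX in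
      ++⁺ (𝒜-vars k S r (C ∷ Δ) tS tr (tC ∷ tΔ)) (𝒜-vars k S (D ∷ r) Δ tS (tD ∷ tr) tΔ)
    leftDisjuncts-vars k S Δ (¬' C)   {r} tS tΔ tX tr (here refl) = 𝒜-vars k S r (C ∷ Δ) tS tr (tX ∷ tΔ)
    leftDisjuncts-vars k S Δ (□ i C)  {r} tS tΔ tX tr (here refl) =
      𝒜-vars k ((i , C) ∷ S) (C ∷ r) Δ (tX ∷ tS) (tX ∷ tr) tΔ

    rightDisjuncts-vars : ∀ k S Γ Δ X {r} → All (VarsIn T) (boxes S) → All (VarsIn T) Γ →
                          VarsIn T X → All (VarsIn T) r →
                          D ∈ rightDisjuncts (𝒜 k) S Γ Δ X r → VarsIn (T ∩ (_≢ p)) D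
    rightDisjuncts-vars k S Γ Δ (var q) tS tΓ (tq ∷ []) tr D∈ with ∈-++⁻ (when (¬? (q ≟ℕ p)) [ var q ]) D∈
    ... | inj₁ D∈ᵛ with ∈-when⁻ (¬? (q ≟ℕ p)) D∈ᵛ
    ...   | q≢p , here refl = (tq , q≢p) ∷ []
    rightDisjuncts-vars k S Γ Δ (var q) tS tΓ (tq ∷ []) tr D∈ | inj₂ D∈ᵀ with ∈-when⁻ (any? (var≡? q) Γ) D∈ᵀ
    ...   | _ , here refl = []
    rightDisjuncts-vars k S Γ Δ (C ∧' D) {r} tS tΓ tX tr (here refl) =
      let tC , tD = ++⁻ (vars C) tX in
      ++⁺ (𝒜-vars k S Γ (C ∷ r) tS tΓ (tC ∷ tr)) (𝒜-vars k S Γ (D ∷ r) tS tΓ (tD ∷ tr))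
    rightDisjuncts-vars k S Γ Δ (C ∨' D) {r} tS tΓ tX tr (here refl) =
      let tC , tD = ++⁻ (vars C) tX in 𝒜-vars k S Γ (C ∷ D ∷ r) tS tΓ (tC ∷ tD ∷ tr)
    rightDisjuncts-vars k S Γ Δ (C ⇒' D) {r} tS tΓ tX tr (here refl) =
      let tC , tD = ++⁻ (vars C) tX in 𝒜-vars k S (C ∷ Γ) (D ∷ r) tS (tC ∷ tΓ) (tD ∷ tr)
    rightDisjuncts-vars k S Γ Δ (¬' C)   {r} tS tΓ tX tr (here refl) = 𝒜-vars k S (C ∷ Γ) r tS (tX ∷ tΓ) tr
    rightDisjuncts-vars k S Γ Δ (□ i C)      tS tΓ tX tr D∈ with ∈-when⁻ (critical? Γ Δ) D∈
    ... | _ , here refl = 𝒜-vars k [] (boxedBy i S) [ C ] [] (All-boxedBy i S tS) (tX ∷ [])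

    ◇-disjunct-vars : ∀ k i G → All (VarsIn T) G → VarsIn (T ∩ (_≢ p)) (◇-disjunct (𝒜 k) i G)
    ◇-disjunct-vars k i []      tG = []
    ◇-disjunct-vars k i (B ∷ G) tG = 𝒜-vars k [] (B ∷ G) [] [] tG []

    𝒜-vars zero    S Γ Δ tS tΓ tΔ = []
    𝒜-vars (suc k) S Γ Δ tS tΓ tΔ = VarsIn-⋁ (disjuncts (𝒜 k) S Γ Δ) disjunct-vars
      where
        disjunct-vars : D ∈ disjuncts (𝒜 k) S Γ Δ → VarsIn (T ∩ (_≢ p)) D
        disjunct-vars D∈ with ∈-disjuncts⁻ (𝒜 k) S Γ Δ D∈
        ... | left  {X} X∈Γ D∈′ = leftDisjuncts-vars k S Δ X tS tΔ (All.lookup tΓ X∈Γ) (─⁺ X∈Γ tΓ) D∈′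
        ... | right {X} X∈Δ D∈′ = rightDisjuncts-vars k S Γ Δ X tS tΓ (All.lookup tΔ X∈Δ) (─⁺ X∈Δ tΔ) D∈′
        ... | diamond _ i refl  = ◇-disjunct-vars k i (boxedBy i S) (All-boxedBy i S tS)

  𝒜-sound : ∀ k S Γ Δ → ⊢ S ∣ 𝒜 k S Γ Δ ∷ Γ ⇒ Δ

  leftDisjuncts-sound : ∀ k S Γ Δ X (X∈Γ : X ∈ Γ) → D ∈ leftDisjuncts (𝒜 k) S Δ X (Γ ─ X∈Γ) →
                        ⊢ S ∣ D ∷ Γ ⇒ Δ
  leftDisjuncts-sound k S Γ Δ (var q) X∈Γ D∈ with ∈-when⁻ (¬? (q ≟ℕ p)) D∈
  ... | _ , here refl = L¬ (focusˡ [] X∈Γ (ax q))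
  leftDisjuncts-sound k S Γ Δ ⊥'       X∈Γ (here refl) = L¬ (focusˡ [] X∈Γ L⊥)
  leftDisjuncts-sound k S Γ Δ (C ∧' D) X∈Γ (here refl) =
    focusˡ [ _ ] X∈Γ (L∧ (permˡ ↭-rotate (𝒜-sound k S (C ∷ D ∷ Γ ─ X∈Γ) Δ)))
  leftDisjuncts-sound k S Γ Δ (C ∨' D) X∈Γ (here refl) = L∧ (focusˡ (A₁ ∷ A₂ ∷ []) X∈Γ (L∨
      (permˡ ↭-reverse₃ (weakenˡ A₂ (𝒜-sound k S (C ∷ Γ ─ X∈Γ) Δ)))
      (permˡ (↭-sym ↭-rotate) (weakenˡ A₁ (𝒜-sound k S (D ∷ Γ ─ X∈Γ) Δ)))))
    where
      A₁ A₂ : Fm n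
      A₁ = 𝒜 k S (C ∷ Γ ─ X∈Γ) Δ
      A₂ = 𝒜 k S (D ∷ Γ ─ X∈Γ) Δ
  leftDisjuncts-sound k S Γ Δ (C ⇒' D) X∈Γ (here refl) = L∧ (focusˡ (A₁ ∷ A₂ ∷ []) X∈Γ (L⇒
      (permˡ ↭-swap₁ (weakenˡ A₂ (𝒜-sound k S (Γ ─ X∈Γ) (C ∷ Δ))))
      (permˡ (↭-sym ↭-rotate) (weakenˡ A₁ (𝒜-sound k S (D ∷ Γ ─ X∈Γ) Δ)))))
    where
      A₁ A₂ : Fm n
      A₁ = 𝒜 k S (Γ ─ X∈Γ) (C ∷ Δ)
      A₂ = 𝒜 k S (D ∷ Γ ─ X∈Γ) Δ
  leftDisjuncts-sound k S Γ Δ (¬' C)   X∈Γ (here refl) = focusˡ [ _ ] X∈Γ (L¬ (𝒜-sound k S (Γ ─ X∈Γ) (C ∷ Δ)))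
  leftDisjuncts-sound k S Γ Δ (□ i C)  X∈Γ (here refl) =
    focusˡ [ _ ] X∈Γ (□T i (permˡ ↭-swap₁ (𝒜-sound k ((i , C) ∷ S) (C ∷ Γ ─ X∈Γ) Δ)))

  rightDisjuncts-sound : ∀ k S Γ Δ X (X∈Δ : X ∈ Δ) → D ∈ rightDisjuncts (𝒜 k) S Γ Δ X (Δ ─ X∈Δ) →
                         ⊢ S ∣ D ∷ Γ ⇒ Δ
  rightDisjuncts-sound k S Γ Δ (var q) X∈Δ D∈ with ∈-++⁻ (when (¬? (q ≟ℕ p)) [ var q ]) D∈
  ... | inj₁ D∈ᵛ with ∈-when⁻ (¬? (q ≟ℕ p)) D∈ᵛ
  ...   | _ , here refl = focusʳ [] X∈Δ (ax q)
  rightDisjuncts-sound k S Γ Δ (var q) X∈Δ D∈ | inj₂ D∈ᵀ with ∈-when⁻ (any? (var≡? q) Γ) D∈ᵀ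
  ...   | q∈Γ , here refl = weakenˡ ⊤' (focusˡ [] q∈Γ (focusʳ [] X∈Δ (ax q)))
  rightDisjuncts-sound k S Γ Δ (C ∧' D) X∈Δ (here refl) = L∧ (focusʳ [] X∈Δ (R∧
      (permˡ ↭-swap₁ (weakenˡ A₂ (𝒜-sound k S Γ (C ∷ Δ ─ X∈Δ))))
      (weakenˡ A₁ (𝒜-sound k S Γ (D ∷ Δ ─ X∈Δ)))))
    where
      A₁ A₂ : Fm n
      A₁ = 𝒜 k S Γ (C ∷ Δ ─ X∈Δ)
      A₂ = 𝒜 k S Γ (D ∷ Δ ─ X∈Δ)
  rightDisjuncts-sound k S Γ Δ (C ∨' D) X∈Δ (here refl) = focusʳ [] X∈Δ (R∨ (𝒜-sound k S Γ (C ∷ D ∷ Δ ─ X∈Δ)))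
  rightDisjuncts-sound k S Γ Δ (C ⇒' D) X∈Δ (here refl) =
    focusʳ [] X∈Δ (R⇒ (permˡ ↭-swap₁ (𝒜-sound k S (C ∷ Γ) (D ∷ Δ ─ X∈Δ))))
  rightDisjuncts-sound k S Γ Δ (¬' C)   X∈Δ (here refl) =
    focusʳ [] X∈Δ (R¬ (permˡ ↭-swap₁ (𝒜-sound k S (C ∷ Γ) (Δ ─ X∈Δ))))
  rightDisjuncts-sound k S Γ Δ (□ i C)  X∈Δ D∈ with ∈-when⁻ (critical? Γ Δ) D∈
  ... | (cΓ , cΔ) , here refl = □T i (weakenˡ A′ (focusʳ [] X∈Δ (□K-boxedBy cΓ (─⁺ X∈Δ cΔ) premise)))
    where
      A′ : Fm n
      A′ = 𝒜 k [] (boxedBy i S) [ C ]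
      premise : ⊢ [] ∣ boxedBy i ((i , A′) ∷ S) ⇒ C ∷ []
      premise = subst (λ G → ⊢ [] ∣ G ⇒ C ∷ []) (sym (boxedBy-∷ i A′ S)) (𝒜-sound k [] (boxedBy i S) [ C ])

  ◇-disjunct-sound : ∀ k S Γ Δ i → Critical Γ Δ → ⊢ S ∣ ◇-disjunct (𝒜 k) i (boxedBy i S) ∷ Γ ⇒ Δ
  ◇-disjunct-sound k S Γ Δ i (cΓ , cΔ) with boxedBy i S in eq
  ... | []    = L⊥
  ... | B ∷ G =
    L¬ (□K-boxedBy cΓ cΔ (subst (λ G′ → ⊢ [] ∣ G′ ⇒ _ ∷ []) (sym eq) (R¬ (𝒜-sound k [] (B ∷ G) []))))

  𝒜-sound zero    S Γ Δ = L⊥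
  𝒜-sound (suc k) S Γ Δ = L⋁ (disjuncts (𝒜 k) S Γ Δ) disjunct-sound
    where
      disjunct-sound : D ∈ disjuncts (𝒜 k) S Γ Δ → ⊢ S ∣ D ∷ Γ ⇒ Δ
      disjunct-sound D∈ with ∈-disjuncts⁻ (𝒜 k) S Γ Δ D∈
      ... | left  X∈Γ D∈′    = leftDisjuncts-sound k S Γ Δ _ X∈Γ D∈′
      ... | right X∈Δ D∈′    = rightDisjuncts-sound k S Γ Δ _ X∈Δ D∈′
      ... | diamond c i refl = ◇-disjunct-sound k S Γ Δ i c

  PFree : Fm n → Set
  PFree = VarsIn (_≢ p)

  PFree-var : ∀ {q} → PFree (var q) → q ≢ p
  PFree-var (q≢p ∷ []) = q≢p

  -- Θ ∣ Π ⇒ Λ is the p-free part of the derived sequent, S ∣ Γ ⇒ Δ the part being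
  -- interpolated; the split is only up to permutation so that `perm` steps pass through.
  Complete : ℕ → List (Boxed n) → List (Fm n) → List (Fm n) → List (Boxed n) → List (Fm n) → List (Fm n) → Set
  Complete k S Γ Δ S' L R = ∀ Θ Π Λ → S' ↭ Θ ++ S → L ↭ Π ++ Γ → R ↭ Δ ++ Λ →
    All PFree (boxes Θ) → All PFree Π → All PFree Λ → ⊢ Θ ∣ Π ⇒ 𝒜 k S Γ Δ ∷ Λ

  R𝒜-left : ∀ k S Γ Δ {Λ} (X∈Γ : X ∈ Γ) → D ∈ leftDisjuncts (𝒜 k) S Δ X (Γ ─ X∈Γ) →
            ⊢ Θ ∣ Π ⇒ D ∷ Λ → ⊢ Θ ∣ Π ⇒ 𝒜 (suc k) S Γ Δ ∷ Λ
  R𝒜-left k S Γ Δ X∈Γ D∈ = R⋁ (∈-++⁺ˡ (∈-concatMapPicks⁺ (leftDisjuncts (𝒜 k) S Δ) X∈Γ D∈))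

  R𝒜-right : ∀ k S Γ Δ {Λ} (X∈Δ : X ∈ Δ) → D ∈ rightDisjuncts (𝒜 k) S Γ Δ X (Δ ─ X∈Δ) →
             ⊢ Θ ∣ Π ⇒ D ∷ Λ → ⊢ Θ ∣ Π ⇒ 𝒜 (suc k) S Γ Δ ∷ Λ
  R𝒜-right k S Γ Δ X∈Δ D∈ = R⋁ (∈-++⁺ʳ (concatMapPicks (leftDisjuncts (𝒜 k) S Δ) Γ)
    (∈-++⁺ˡ (∈-concatMapPicks⁺ (rightDisjuncts (𝒜 k) S Γ Δ) X∈Δ D∈)))

  R𝒜-◇ : ∀ k S Γ Δ {Λ} → Critical Γ Δ → ∀ i →
         ⊢ Θ ∣ Π ⇒ ◇-disjunct (𝒜 k) i (boxedBy i S) ∷ Λ → ⊢ Θ ∣ Π ⇒ 𝒜 (suc k) S Γ Δ ∷ Λ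
  R𝒜-◇ k S Γ Δ c i = R⋁ (∈-++⁺ʳ (concatMapPicks (leftDisjuncts (𝒜 k) S Δ) Γ)
    (∈-++⁺ʳ (concatMapPicks (rightDisjuncts (𝒜 k) S Γ Δ) Δ)
      (∈-when⁺ (critical? Γ Δ) c (∈-map⁺ (λ i → ◇-disjunct (𝒜 k) i (boxedBy i S)) (∈-allFin i)))))

  ◇□K : All AtomOrBot Π → All AtomBotOrBoxed Ω → ⊢ [] ∣ boxedBy i Θ ⇒ B ∷ C ∷ [] →
        ⊢ Θ ∣ Π ⇒ ¬' □ i (¬' B) ∷ □ i C ∷ Ω
  ◇□K {i = i} {Θ = Θ} {B = B} {C = C} π ω d = R¬ (□T i (L¬ (weakenʳ B (□K-boxedBy π ω premise))))
    where
      premise : ⊢ [] ∣ boxedBy i ((i , ¬' B) ∷ Θ) ⇒ C ∷ []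
      premise = subst (λ G → ⊢ [] ∣ G ⇒ C ∷ []) (sym (boxedBy-∷ i (¬' B) Θ)) (L¬ d)

  Interpolable : List (Boxed n) → List (Fm n) → List (Fm n) → Set
  Interpolable S' L R = ∀ k S Γ Δ → size S Γ Δ < k → Complete k S Γ Δ S' L R

  perm-interpolable : ∀ {S₁ L₁ R₁} → S₁ ↭ S' → L₁ ↭ L → R₁ ↭ R → Interpolable S₁ L₁ R₁ → Interpolable S' L R
  perm-interpolable σ γ δ ih k S Γ Δ lt Θ Π Λ hS hL hR =
    ih k S Γ Δ lt Θ Π Λ (↭-trans σ hS) (↭-trans γ hL) (↭-trans δ hR)

  ax-interpolable : ∀ q → Interpolable S' (var q ∷ L) (var q ∷ R)
  ax-interpolable q (suc k) S Γ Δ _ Θ Π Λ _ hL hR _ fΠ fΛ with ∷↭++⁻ Π Γ hL | ∷↭++⁻ Δ Λ hR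
  ... | inj₁ (q∈Π , _) | inj₁ (q∈Δ , _) =
    R𝒜-right k S Γ Δ q∈Δ (∈-++⁺ˡ (∈-when⁺ (¬? (q ≟ℕ p)) (PFree-var (All.lookup fΠ q∈Π)) (here refl)))
      (focusˡ [] q∈Π (ax q))
  ... | inj₁ (q∈Π , _) | inj₂ (q∈Λ , _) = focusˡ [] q∈Π (focusʳ [ _ ] q∈Λ (ax q))
  ... | inj₂ (q∈Γ , _) | inj₁ (q∈Δ , _) =
    R𝒜-right k S Γ Δ q∈Δ (∈-++⁺ʳ (when (¬? (q ≟ℕ p)) [ var q ]) (∈-when⁺ (any? (var≡? q) Γ) q∈Γ (here refl)))
      (R¬ L⊥)
  ... | inj₂ (q∈Γ , _) | inj₂ (q∈Λ , _) =
    R𝒜-left k S Γ Δ q∈Γ (∈-when⁺ (¬? (q ≟ℕ p)) (PFree-var (All.lookup fΛ q∈Λ)) (here refl))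
      (R¬ (focusʳ [] q∈Λ (ax q)))

  L⊥-interpolable : Interpolable S' (⊥' ∷ L) R
  L⊥-interpolable (suc k) S Γ Δ _ Θ Π Λ _ hL _ _ _ _ with ∷↭++⁻ Π Γ hL
  ... | inj₁ (⊥∈Π , _) = focusˡ [] ⊥∈Π L⊥
  ... | inj₂ (⊥∈Γ , _) = R𝒜-left k S Γ Δ ⊥∈Γ (here refl) (R¬ L⊥)

  R∧-interpolable : Interpolable S' L (C ∷ R) → Interpolable S' L (D ∷ R) → Interpolable S' L (C ∧' D ∷ R)
  R∧-interpolable {C = C} {D = D} ih₁ ih₂ (suc k) S Γ Δ (s≤s lt) Θ Π Λ hS hL hR fΘ fΠ fΛ with ∷↭++⁻ Δ Λ hR
  ... | inj₁ (X∈Δ , h) = R𝒜-right k S Γ Δ X∈Δ (here refl) (R∧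
      (ih₁ k S Γ (C ∷ Δ ─ X∈Δ) (<-≤-trans (size-R∧₁ S Γ Δ X∈Δ) lt) Θ Π Λ hS hL (↭-prep C h) fΘ fΠ fΛ)
      (ih₂ k S Γ (D ∷ Δ ─ X∈Δ) (<-≤-trans (size-R∧₂ S Γ Δ X∈Δ) lt) Θ Π Λ hS hL (↭-prep D h) fΘ fΠ fΛ))
  ... | inj₂ (X∈Λ , h) =
    let fC , fD = ++⁻ (vars C) (All.lookup fΛ X∈Λ) in
    focusʳ [ _ ] X∈Λ (R∧
      (permʳ ↭-swap₁ (ih₁ (suc k) S Γ Δ (s≤s lt) Θ Π (C ∷ Λ ─ X∈Λ) hS hL (↭-++-shift [ C ] h)
        fΘ fΠ (fC ∷ ─⁺ X∈Λ fΛ)))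
      (permʳ ↭-swap₁ (ih₂ (suc k) S Γ Δ (s≤s lt) Θ Π (D ∷ Λ ─ X∈Λ) hS hL (↭-++-shift [ D ] h)
        fΘ fΠ (fD ∷ ─⁺ X∈Λ fΛ))))

  L∧-interpolable : Interpolable S' (C ∷ D ∷ L) R → Interpolable S' (C ∧' D ∷ L) R
  L∧-interpolable {C = C} {D = D} ih (suc k) S Γ Δ (s≤s lt) Θ Π Λ hS hL hR fΘ fΠ fΛ with ∷↭++⁻ Π Γ hL
  ... | inj₁ (X∈Π , h) =
    let fC , fD = ++⁻ (vars C) (All.lookup fΠ X∈Π) in
    focusˡ [] X∈Π (L∧ (ih (suc k) S Γ Δ (s≤s lt) Θ (C ∷ D ∷ Π ─ X∈Π) Λ hS (↭-prep C (↭-prep D h)) hR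
      fΘ (fC ∷ fD ∷ ─⁺ X∈Π fΠ) fΛ))
  ... | inj₂ (X∈Γ , h) = R𝒜-left k S Γ Δ X∈Γ (here refl)
      (ih k S (C ∷ D ∷ Γ ─ X∈Γ) Δ (<-≤-trans (size-L∧ S Γ Δ X∈Γ) lt) Θ Π Λ hS (↭-++-shift (C ∷ D ∷ []) h) hR
        fΘ fΠ fΛ)

  R∨-interpolable : Interpolable S' L (C ∷ D ∷ R) → Interpolable S' L (C ∨' D ∷ R)
  R∨-interpolable {C = C} {D = D} ih (suc k) S Γ Δ (s≤s lt) Θ Π Λ hS hL hR fΘ fΠ fΛ with ∷↭++⁻ Δ Λ hR
  ... | inj₁ (X∈Δ , h) = R𝒜-right k S Γ Δ X∈Δ (here refl)
      (ih k S Γ (C ∷ D ∷ Δ ─ X∈Δ) (<-≤-trans (size-R∨ S Γ Δ X∈Δ) lt) Θ Π Λ hS hL (↭-prep C (↭-prep D h))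
        fΘ fΠ fΛ)
  ... | inj₂ (X∈Λ , h) =
    let fC , fD = ++⁻ (vars C) (All.lookup fΛ X∈Λ) in
    focusʳ [ _ ] X∈Λ (R∨ (permʳ ↭-rotate
      (ih (suc k) S Γ Δ (s≤s lt) Θ Π (C ∷ D ∷ Λ ─ X∈Λ) hS hL (↭-++-shift (C ∷ D ∷ []) h)
        fΘ fΠ (fC ∷ fD ∷ ─⁺ X∈Λ fΛ))))

  L∨-interpolable : Interpolable S' (C ∷ L) R → Interpolable S' (D ∷ L) R → Interpolable S' (C ∨' D ∷ L) R
  L∨-interpolable {C = C} {D = D} ih₁ ih₂ (suc k) S Γ Δ (s≤s lt) Θ Π Λ hS hL hR fΘ fΠ fΛ with ∷↭++⁻ Π Γ hL
  ... | inj₁ (X∈Π , h) =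
    let fC , fD = ++⁻ (vars C) (All.lookup fΠ X∈Π) in
    focusˡ [] X∈Π (L∨
      (ih₁ (suc k) S Γ Δ (s≤s lt) Θ (C ∷ Π ─ X∈Π) Λ hS (↭-prep C h) hR fΘ (fC ∷ ─⁺ X∈Π fΠ) fΛ)
      (ih₂ (suc k) S Γ Δ (s≤s lt) Θ (D ∷ Π ─ X∈Π) Λ hS (↭-prep D h) hR fΘ (fD ∷ ─⁺ X∈Π fΠ) fΛ))
  ... | inj₂ (X∈Γ , h) = R𝒜-left k S Γ Δ X∈Γ (here refl) (R∧
      (ih₁ k S (C ∷ Γ ─ X∈Γ) Δ (<-≤-trans (size-L∨₁ S Γ Δ X∈Γ) lt) Θ Π Λ hS (↭-++-shift [ C ] h) hR fΘ fΠ fΛ)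
      (ih₂ k S (D ∷ Γ ─ X∈Γ) Δ (<-≤-trans (size-L∨₂ S Γ Δ X∈Γ) lt) Θ Π Λ hS (↭-++-shift [ D ] h) hR fΘ fΠ fΛ))

  R⇒-interpolable : Interpolable S' (C ∷ L) (D ∷ R) → Interpolable S' L (C ⇒' D ∷ R)
  R⇒-interpolable {C = C} {D = D} ih (suc k) S Γ Δ (s≤s lt) Θ Π Λ hS hL hR fΘ fΠ fΛ with ∷↭++⁻ Δ Λ hR
  ... | inj₁ (X∈Δ , h) = R𝒜-right k S Γ Δ X∈Δ (here refl)
      (ih k S (C ∷ Γ) (D ∷ Δ ─ X∈Δ) (<-≤-trans (size-R⇒ S Γ Δ X∈Δ) lt) Θ Π Λ hS (↭-++-shift [ C ] hL)
        (↭-prep D h) fΘ fΠ fΛ)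
  ... | inj₂ (X∈Λ , h) =
    let fC , fD = ++⁻ (vars C) (All.lookup fΛ X∈Λ) in
    focusʳ [ _ ] X∈Λ (R⇒ (permʳ ↭-swap₁
      (ih (suc k) S Γ Δ (s≤s lt) Θ (C ∷ Π) (D ∷ Λ ─ X∈Λ) hS (↭-prep C hL) (↭-++-shift [ D ] h)
        fΘ (fC ∷ fΠ) (fD ∷ ─⁺ X∈Λ fΛ))))

  L⇒-interpolable : Interpolable S' L (C ∷ R) → Interpolable S' (D ∷ L) R → Interpolable S' (C ⇒' D ∷ L) R
  L⇒-interpolable {C = C} {D = D} ih₁ ih₂ (suc k) S Γ Δ (s≤s lt) Θ Π Λ hS hL hR fΘ fΠ fΛ with ∷↭++⁻ Π Γ hL
  ... | inj₁ (X∈Π , h) =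
    let fC , fD = ++⁻ (vars C) (All.lookup fΠ X∈Π) in
    focusˡ [] X∈Π (L⇒
      (permʳ ↭-swap₁ (ih₁ (suc k) S Γ Δ (s≤s lt) Θ (Π ─ X∈Π) (C ∷ Λ) hS h (↭-++-shift [ C ] hR)
        fΘ (─⁺ X∈Π fΠ) (fC ∷ fΛ)))
      (ih₂ (suc k) S Γ Δ (s≤s lt) Θ (D ∷ Π ─ X∈Π) Λ hS (↭-prep D h) hR fΘ (fD ∷ ─⁺ X∈Π fΠ) fΛ))
  ... | inj₂ (X∈Γ , h) = R𝒜-left k S Γ Δ X∈Γ (here refl) (R∧
      (ih₁ k S (Γ ─ X∈Γ) (C ∷ Δ) (<-≤-trans (size-L⇒₁ S Γ Δ X∈Γ) lt) Θ Π Λ hS h (↭-prep C hR) fΘ fΠ fΛ)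
      (ih₂ k S (D ∷ Γ ─ X∈Γ) Δ (<-≤-trans (size-L⇒₂ S Γ Δ X∈Γ) lt) Θ Π Λ hS (↭-++-shift [ D ] h) hR fΘ fΠ fΛ))

  R¬-interpolable : Interpolable S' (C ∷ L) R → Interpolable S' L (¬' C ∷ R)
  R¬-interpolable {C = C} ih (suc k) S Γ Δ (s≤s lt) Θ Π Λ hS hL hR fΘ fΠ fΛ with ∷↭++⁻ Δ Λ hR
  ... | inj₁ (X∈Δ , h) = R𝒜-right k S Γ Δ X∈Δ (here refl)
      (ih k S (C ∷ Γ) (Δ ─ X∈Δ) (<-≤-trans (size-R¬ S Γ Δ X∈Δ) lt) Θ Π Λ hS (↭-++-shift [ C ] hL) h fΘ fΠ fΛ)
  ... | inj₂ (X∈Λ , h) = focusʳ [ _ ] X∈Λ (R¬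
      (ih (suc k) S Γ Δ (s≤s lt) Θ (C ∷ Π) (Λ ─ X∈Λ) hS (↭-prep C hL) h
        fΘ (All.lookup fΛ X∈Λ ∷ fΠ) (─⁺ X∈Λ fΛ)))

  L¬-interpolable : Interpolable S' L (C ∷ R) → Interpolable S' (¬' C ∷ L) R
  L¬-interpolable {C = C} ih (suc k) S Γ Δ (s≤s lt) Θ Π Λ hS hL hR fΘ fΠ fΛ with ∷↭++⁻ Π Γ hL
  ... | inj₁ (X∈Π , h) = focusˡ [] X∈Π (L¬ (permʳ ↭-swap₁
      (ih (suc k) S Γ Δ (s≤s lt) Θ (Π ─ X∈Π) (C ∷ Λ) hS h (↭-++-shift [ C ] hR)
        fΘ (─⁺ X∈Π fΠ) (All.lookup fΠ X∈Π ∷ fΛ))))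
  ... | inj₂ (X∈Γ , h) = R𝒜-left k S Γ Δ X∈Γ (here refl)
      (ih k S (Γ ─ X∈Γ) (C ∷ Δ) (<-≤-trans (size-L¬ S Γ Δ X∈Γ) lt) Θ Π Λ hS h (↭-prep C hR) fΘ fΠ fΛ)

  □T-interpolable : ∀ i → Interpolable ((i , C) ∷ S') (C ∷ L) R → Interpolable S' (□ i C ∷ L) R
  □T-interpolable {C = C} i ih (suc k) S Γ Δ (s≤s lt) Θ Π Λ hS hL hR fΘ fΠ fΛ with ∷↭++⁻ Π Γ hL
  ... | inj₁ (X∈Π , h) =
    let fC = All.lookup fΠ X∈Π in
    focusˡ [] X∈Π (□T i (ih (suc k) S Γ Δ (s≤s lt) ((i , C) ∷ Θ) (C ∷ Π ─ X∈Π) Λ (↭-prep _ hS) (↭-prep C h) hR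
      (fC ∷ fΘ) (fC ∷ ─⁺ X∈Π fΠ) fΛ))
  ... | inj₂ (X∈Γ , h) = R𝒜-left k S Γ Δ X∈Γ (here refl)
      (ih k ((i , C) ∷ S) (C ∷ Γ ─ X∈Γ) Δ (<-≤-trans (size-L□ S Γ Δ X∈Γ) lt) Θ Π Λ
        (↭-++-shift [ i , C ] hS) (↭-++-shift [ C ] h) hR fΘ fΠ fΛ)

  ◇-disjunct-complete : ⊢ [] ∣ G ⇒ C ∷ [] → Interpolable [] G (C ∷ []) →
                        ∀ k S Γ Δ i → size S Γ Δ ≤ k → All AtomOrBot Π → All AtomBotOrBoxed Ω →
                        G ↭ boxedBy i Θ ++ boxedBy i S → All PFree (boxedBy i Θ) → PFree C →
                        ⊢ Θ ∣ Π ⇒ ◇-disjunct (𝒜 k) i (boxedBy i S) ∷ □ i C ∷ Ω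
  ◇-disjunct-complete {C = C} {Θ = Θ} d ih k S Γ Δ i lt π ω G↭ fΘᵢ fC with boxedBy i S in eq
  ... | []    = weakenʳ ⊥' (□K-boxedBy π ω (permˡ (↭-trans G↭ (++-identityʳ _)) d))
  ... | B ∷ G = ◇□K π ω (ih k [] (B ∷ G) [] (<-≤-trans (size-◇ S Γ Δ i eq) lt) [] (boxedBy i Θ) [ C ]
      ↭-refl G↭ ↭-refl [] fΘᵢ (fC ∷ []))

  □K-interpolable : ∀ {S₀ G} i → All (DiffAgent i) S₀ → All AtomOrBot L → All AtomBotOrBoxed R →
                    ⊢ [] ∣ G ⇒ C ∷ [] → Interpolable [] G (C ∷ []) →
                    Interpolable (S₀ ++ map (i ,_) G) L (□ i C ∷ R)
  □K-interpolable {L = L} {R = R} {C = C} {G = G} i s π ω d ih (suc k) S Γ Δ (s≤s lt) Θ Π Λ hS hL hR fΘ fΠ fΛ =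
    principal (∷↭++⁻ Δ Λ hR)
    where
      aΠ : All AtomOrBot Π
      aΠ = proj₁ (++⁻ Π (All-resp-↭ hL π))
      aΓ : All AtomOrBot Γ
      aΓ = proj₂ (++⁻ Π (All-resp-↭ hL π))
      aΔ : All AtomBotOrBoxed Δ
      aΔ = proj₁ (++⁻ Δ (All-resp-↭ hR (boxed i C ∷ ω)))
      aΛ : All AtomBotOrBoxed Λ
      aΛ = proj₂ (++⁻ Δ (All-resp-↭ hR (boxed i C ∷ ω)))
      G↭ : G ↭ boxedBy i Θ ++ boxedBy i S
      G↭ = subst (G ↭_) (boxedBy-++ i Θ S) (boxedBy-□K s hS)
      fΘᵢ : All PFree (boxedBy i Θ)
      fΘᵢ = All-boxedBy i Θ fΘ

      principal : (Σ[ X∈Δ ∈ □ i C ∈ Δ ] R ↭ (Δ ─ X∈Δ) ++ Λ) ⊎ (Σ[ X∈Λ ∈ □ i C ∈ Λ ] R ↭ Δ ++ (Λ ─ X∈Λ)) →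
                  ⊢ Θ ∣ Π ⇒ 𝒜 (suc k) S Γ Δ ∷ Λ
      principal (inj₁ (X∈Δ , _)) = R𝒜-right k S Γ Δ X∈Δ (∈-when⁺ (critical? Γ Δ) (aΓ , aΔ) (here refl))
        (□K-boxedBy aΠ aΛ (ih k [] (boxedBy i S) [ C ] (<-≤-trans (size-R□ S Γ Δ X∈Δ) lt)
          [] (boxedBy i Θ) [] ↭-refl G↭ ↭-refl [] fΘᵢ []))
      principal (inj₂ (X∈Λ , _)) = R𝒜-◇ k S Γ Δ (aΓ , aΔ) i (focusʳ [ _ ] X∈Λ (permʳ ↭-swap₁
        (◇-disjunct-complete d ih k S Γ Δ i lt aΠ (─⁺ X∈Λ aΛ) G↭ fΘᵢ (All.lookup fΛ X∈Λ))))

  ⊢⇒interpolable : ⊢ S' ∣ L ⇒ R → Interpolable S' L R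
  ⊢⇒interpolable (perm σ γ δ d)   = perm-interpolable σ γ δ (⊢⇒interpolable d)
  ⊢⇒interpolable (ax q)           = ax-interpolable q
  ⊢⇒interpolable L⊥               = L⊥-interpolable
  ⊢⇒interpolable (R∧ d e)         = R∧-interpolable (⊢⇒interpolable d) (⊢⇒interpolable e)
  ⊢⇒interpolable (L∧ d)           = L∧-interpolable (⊢⇒interpolable d)
  ⊢⇒interpolable (R∨ d)           = R∨-interpolable (⊢⇒interpolable d)
  ⊢⇒interpolable (L∨ d e)         = L∨-interpolable (⊢⇒interpolable d) (⊢⇒interpolable e)
  ⊢⇒interpolable (R⇒ d)           = R⇒-interpolable (⊢⇒interpolable d)
  ⊢⇒interpolable (L⇒ d e)         = L⇒-interpolable (⊢⇒interpolable d) (⊢⇒interpolable e)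
  ⊢⇒interpolable (R¬ d)           = R¬-interpolable (⊢⇒interpolable d)
  ⊢⇒interpolable (L¬ d)           = L¬-interpolable (⊢⇒interpolable d)
  ⊢⇒interpolable (□T i d)         = □T-interpolable i (⊢⇒interpolable d)
  ⊢⇒interpolable (□K i s π ω d)   = □K-interpolable i s π ω d (⊢⇒interpolable d)

theorem4p16 : {n : ℕ} (Σ : List (Boxed n)) (Γ Δ : List (Fm n)) (p : ℕ) →
    Σ[ A ∈ Fm n ]
      ((∀ q → q ∈ vars A → q ∈ varsL (boxes Σ ++ Γ ++ Δ) × q ≢ p)
      × (⊢ Σ ∣ Γ ++ A ∷ [] ⇒ Δ)
      × ((Π Λ : List (Fm n)) (Θ : List (Boxed n)) →
          p ∉ varsL (Π ++ Λ ++ boxes Θ) →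
          ⊢ Θ ++ Σ ∣ Π ++ Γ ⇒ Δ ++ Λ →
          ⊢ [] ∣ boxes Θ ++ Π ⇒ A ∷ Λ))
theorem4p16 {n} Σ Γ Δ p = A , vars-A , sound-A , complete-A
  where
    open UniformInterpolant p

    fuel : ℕ
    fuel = suc (size Σ Γ Δ)

    A : Fm n
    A = 𝒜 fuel Σ Γ Δ

    vars-A : ∀ q → q ∈ vars A → q ∈ varsL (boxes Σ ++ Γ ++ Δ) × q ≢ p
    vars-A q =
      let tΣ , tΓ , tΔ = All-++⁻₃ (boxes Σ) Γ (All-VarsIn (boxes Σ ++ Γ ++ Δ) λ q∈ → q∈)
      in All.lookup (𝒜-vars fuel Σ Γ Δ tΣ tΓ tΔ)

    sound-A : ⊢ Σ ∣ Γ ++ A ∷ [] ⇒ Δ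
    sound-A = permˡ (∷↭∷ʳ A Γ) (𝒜-sound fuel Σ Γ Δ)

    complete-A : (Π Λ : List (Fm n)) (Θ : List (Boxed n)) → p ∉ varsL (Π ++ Λ ++ boxes Θ) →
                 ⊢ Θ ++ Σ ∣ Π ++ Γ ⇒ Δ ++ Λ → ⊢ [] ∣ boxes Θ ++ Π ⇒ A ∷ Λ
    complete-A Π Λ Θ p∉ d =
      let fΠ , fΛ , fΘ = All-++⁻₃ Π Λ (All-VarsIn (Π ++ Λ ++ boxes Θ) λ { q∈ refl → p∉ q∈ })
      in □T-many Θ (permˢ (↭-sym (++-identityʳ Θ))
           (⊢⇒interpolable d fuel Σ Γ Δ (n<1+n _) Θ Π Λ ↭-refl ↭-refl ↭-refl fΘ fΠ fΛ))
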